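{- Let $\mathcal{P}\subset\mathbb{R}_{\ge0}^n$ be an anti-blocking lattice polytope of dimension $n$, $A=\mathcal{P}\cap\mathbb{Z}^n$, and let $\Lambda=((\mathbf{a}_1,\varepsilon_1),\dots,(\mathbf{a}_{r-2},\varepsilon_{r-2}),(\mathbf{a},\varepsilon),(\mathbf{b},\delta))$ and $\Lambda'=((\mathbf{a}_1,\varepsilon_1),\dots,(\mathbf{a}_{r-2},\varepsilon_{r-2}),(\mathbf{a}',\varepsilon'),(\mathbf{b}',\delta'))$ be ordered lists with $\mathbf{a}_j,\mathbf{a},\mathbf{b},\mathbf{a}',\mathbf{b}'\in A$ and $\varepsilon_j,\varepsilon,\delta,\varepsilon',\delta'\in\{ -1,1\}^n$. Suppose $\omega(\Lambda)=\omega(\Lambda')\in\mathbb{Z}_{\ge0}^n$. Then $m(\nu(\Lambda))-m(\nu(\Lambda'))$ is a monomial multiple of a quadratic binomial in $I_{\mathcal{P}}$, i.e., it equals $M\cdot(x_{\mathbf{c}}x_{\mathbf{d}}-x_{\mathbf{c}'}x_{\mathbf{d}'})$ for some monomial $M\in K[x_{\mathbf{a}}:\mathbf{a}\in A]$ and some $\mathbf{c},\mathbf{d},\mathbf{c}',\mathbf{d}'\in A$ with $x_{\mathbf{c}}x_{\mathbf{d}}-x_{\mathbf{c}'}x_{\mathbf{d}'}\in I_{\mathcal{P}}$.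
   Context: A lattice polytope $\mathcal{P}\subset\mathbb{R}_{\ge0}^n$ of dimension $n$ with integer vertices is anti-blocking if for every $\mathbf{y}\in\mathcal{P}$ and $\mathbf{x}\in\mathbb{R}^n$ with $0\le x_i\le y_i$ for all $i$, $\mathbf{x}\in\mathcal{P}$. $K$ is a field; the toric ideal $I_{\mathcal{P}}$ is the kernel of $K[x_{\mathbf{a}}:\mathbf{a}\in A]\to K[t_1^{\pm1},\dots,t_n^{\pm1},s]$, $x_{\mathbf{a}}\mapsto t_1^{a_1}\cdots t_n^{a_n}s$. For $\varepsilon\in\{ -1,1\}^n$, $\varepsilon\mathbf{x}:=(\varepsilon_1x_1,\dots,\varepsilon_nx_n)$. For an ordered list $\Lambda=((\mathbf{a}_1,\varepsilon_1),\dots,(\mathbf{a}_r,\varepsilon_r))$ with $\mathbf{a}_j=(a_{j,1},\dots,a_{j,n})\in A$, $\varepsilon_j=(\varepsilon_{j,1},\dots,\varepsilon_{j,n})\in\{ -1,1\}^n$, set $\omega(\Lambda)=(\omega_1(\Lambda),\dots,\omega_n(\Lambda)):=\sum_j\varepsilon_j\mathbf{a}_j$. When $\omega(\Lambda)\ge0$: for $k\in[n]$, $P_k(\Lambda)$ is the ordered list $(1,\dots,1,2,\dots,2,\dots,r,\dots,r)$ in which $j$ appears $a_{j,k}$ times if $\varepsilon_{j,k}=1$ and $0$ times if $\varepsilon_{j,k}=-1$; $c_{j,k}(\Lambda)$ is the number of times $j$ appears among the first $\omega_k(\Lambda)$ entries of $P_k(\Lambda)$; $\mathbf{c}_j(\Lambda)=(c_{j,1}(\Lambda),\dots,c_{j,n}(\Lambda))$,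 which lies in $A$; $\nu(\Lambda)=(\mathbf{c}_1(\Lambda),\dots,\mathbf{c}_r(\Lambda))$ and $m(\nu(\Lambda))=x_{\mathbf{c}_1(\Lambda)}\cdots x_{\mathbf{c}_r(\Lambda)}\in K[x_{\mathbf{a}}:\mathbf{a}\in A]$. -}

module Defs where

open import Data.Nat as ℕ using (ℕ; zero; suc)
open import Data.Nat.Properties using (_≟_)
open import Data.Integer as ℤ using (ℤ; _◃_)
open import Data.Rational as ℚ using (ℚ; 0ℚ; 1ℚ)
open import Data.Sign using (Sign)
open import Data.Fin using (Fin) renaming (zero to fzero; suc to fsuc)
open import Data.Vec as Vec using (Vec; lookup; tabulate)
open import Data.List as List using (List; []; _∷_; _++_; length; take; replicate; concat; map)
open import Data.List.Relation.Unary.All using (All)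
open import Data.Product using (Σ; ∃; _×_; _,_; proj₁; proj₂)
open import Relation.Binary.PropositionalEquality using (_≡_)
open import Relation.Nullary using (yes; no)

sumℚ : ∀ k → (Fin k → ℚ) → ℚ
sumℚ zero    f = 0ℚ
sumℚ (suc k) f = f fzero ℚ.+ sumℚ k (λ i → f (fsuc i))

ℕtoℚ : ℕ → ℚ
ℕtoℚ m = ℤ.+ m ℚ./ 1

-- Lattice polytopes in ℝ^n_{≥0}, given as the convex hull of k integer
-- (hence, being in the nonnegative orthant, natural-number) vertices
-- V 0, …, V (k-1).  Points of the ambient space are taken rational.

Point : ℕ → Set
Point n = Fin n → ℚ

InP : ∀ {n k} → (Fin k → Vec ℕ n) → Point n → Set
InP {n} {k} V x =
  Σ (Fin k → ℚ) λ λs →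
    (∀ j → 0ℚ ℚ.≤ λs j) ×
    (sumℚ k λs ≡ 1ℚ) ×
    (∀ i → x i ≡ sumℚ k (λ j → λs j ℚ.* ℕtoℚ (lookup (V j) i)))

AntiBlocking : ∀ {n k} → (Fin k → Vec ℕ n) → Set
AntiBlocking {n} V =
  ∀ (y x : Point n) → InP V y → (∀ i → (0ℚ ℚ.≤ x i) × (x i ℚ.≤ y i)) → InP V x

FullDimensional : ∀ {n k} → (Fin k → Vec ℕ n) → Set
FullDimensional {n} {k} V =
  ∀ (c : Fin n → ℚ) (b : ℚ) →
    (∀ j → sumℚ n (λ i → c i ℚ.* ℕtoℚ (lookup (V j) i)) ≡ b) →
    ∀ i → c i ≡ 0ℚ

-- A = P ∩ ℤ^n  (integer points of P are nonnegative, so lie in ℕ^n)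
InA : ∀ {n k} → (Fin k → Vec ℕ n) → Vec ℕ n → Set
InA V a = InP V (λ i → ℕtoℚ (lookup a i))

-- Monomials of K[x_a : a ∈ A] are represented by the multiset of their
-- variable indices (a list, considered up to permutation _↭_).

Monomial : ℕ → Set
Monomial n = List (Vec ℕ n)

-- image of a monomial x_{a₁}⋯x_{a_r} under x_a ↦ t^a s : the exponent
-- vector of the Laurent monomial t₁^{…}⋯tₙ^{…} s^{r}
toricImage : ∀ {n} → Monomial n → Vec ℤ n × ℕ
toricImage {n} []       = Vec.replicate n (ℤ.+ 0) , 0
toricImage {n} (a ∷ as) =
  Vec.zipWith ℤ._+_ (Vec.map ℤ.+_ a) (proj₁ (toricImage as)) ,
  suc (proj₂ (toricImage as))

-- the binomial u - v lies in the toric ideal I_P (the kernel of the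
-- monomial map) iff u and v have the same image
BinomialInToricIdeal : ∀ {n} → Monomial n → Monomial n → Set
BinomialInToricIdeal u v = toricImage u ≡ toricImage v

SignedList : ℕ → Set
SignedList n = List (Vec ℕ n × Vec Sign n)

signed : ∀ {n} → Vec Sign n → Vec ℕ n → Vec ℤ n
signed ε a = Vec.zipWith _◃_ ε a

ω : ∀ {n} → SignedList n → Vec ℤ n
ω {n} []             = Vec.replicate n (ℤ.+ 0)
ω {n} ((a , ε) ∷ Λ)  = Vec.zipWith ℤ._+_ (signed ε a) (ω Λ)

-- number of copies of j in P_k contributed by (a_j, ε_j)
mult : ∀ {n} → Fin n → Vec ℕ n × Vec Sign n → ℕ
mult k (a , ε) with lookup ε k
... | Sign.+ = lookup a k
... | Sign.- = 0

-- entries indexed 1,…,r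
indexFrom : ∀ {A : Set} → ℕ → List A → List (ℕ × A)
indexFrom j []       = []
indexFrom j (x ∷ xs) = (j , x) ∷ indexFrom (suc j) xs

Pk : ∀ {n} → Fin n → SignedList n → List ℕ
Pk k Λ = concat (map (λ { (j , p) → replicate (mult k p) j }) (indexFrom 1 Λ))

countℕ : ℕ → List ℕ → ℕ
countℕ j []       = 0
countℕ j (x ∷ xs) with j ≟ x
... | yes _ = suc (countℕ j xs)
... | no  _ = countℕ j xs

-- c_{j,k}(Λ) : occurrences of j among the first ω_k(Λ) entries of P_k(Λ)
-- (used only when ω(Λ) ≥ 0, so ω_k(Λ) = ∣ω_k(Λ)∣)
c : ∀ {n} → SignedList n → ℕ → Fin n → ℕ
c Λ j k = countℕ j (take ℤ.∣ lookup (ω Λ) k ∣ (Pk k Λ))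

ν : ∀ {n} → SignedList n → List (Vec ℕ n)
ν Λ = map (λ { (j , _) → tabulate (c Λ j) }) (indexFrom 1 Λ)

mν : ∀ {n} → SignedList n → Monomial n
mν Λ = ν Λ

{-# OPTIONS --safe #-}
module Submission where

-- The entries of P_k(Λ) are sorted by index, so for j ≤ |L| the count c_{j,k}(Λ) only sees the
-- prefix P_k(L): it depends on L and ω_k(Λ) alone, and Λ, Λ′ share the monomial M of these
-- c_j.  Since 0 ≤ ω_k(Λ) ≤ |P_k(Λ)|, the last two counts add up to ω_k(Λ) ∸ |P_k(L)|, which is
-- the same for Λ′; equal column sums put the quadratic binomial in I_P.  Finally
-- c_j(Λ) ≤ a_j coordinatewise, so anti-blocking keeps every c_j(Λ) in A.

open import Defs
open import Data.Nat using (ℕ; zero; suc; _+_; _∸_; z≤n)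
import Data.Nat as ℕ
import Data.Nat.Properties as ℕ
import Data.Nat.Coprimality as Coprimality
open import Data.Integer using (_≤_; +_; _◃_; ∣_∣)
import Data.Integer as ℤ
import Data.Integer.Properties as ℤ
open import Data.Rational as ℚ using (mkℚ)
import Data.Rational.Properties as ℚ
open import Data.Sign using (Sign)
open import Data.Fin using (Fin)
open import Data.Vec using (Vec; lookup; tabulate)
import Data.Vec as Vec
import Data.Vec.Properties as Vec
open import Data.Vec.Relation.Binary.Pointwise.Extensional using (ext; Pointwise-≡⇒≡)
open import Data.List using (List; []; _∷_; _++_; length; take; replicate; concat; map)
open import Data.Nat.ListAction using (sum)
import Data.List.Properties as List
open import Data.List.Relation.Unary.All as All using (All; []; _∷_)
import Data.List.Relation.Unary.All.Properties as All
open import Data.List.Relation.Binary.Permutation.Propositional using (_↭_; ↭-reflexive)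
open import Data.Product using (Σ; _×_; _,_; proj₁; proj₂)
open import Data.Sum using (_⊎_; inj₁; inj₂)
open import Function using (_∘_)
open import Relation.Binary.PropositionalEquality
open import Relation.Nullary using (yes; no; contradiction)

ℕtoℚ-normal : ∀ m → ℕtoℚ m ≡ mkℚ (+ m) 0 (Coprimality.sym (Coprimality.1-coprimeTo m))
ℕtoℚ-normal m = ℚ.↥p/↧p≡p _

ℕtoℚ-mono-≤ : ∀ {m n} → m ℕ.≤ n → ℕtoℚ m ℚ.≤ ℕtoℚ n
ℕtoℚ-mono-≤ {m} {n} m≤n rewrite ℕtoℚ-normal m | ℕtoℚ-normal n =
  ℚ.*≤* (subst₂ _≤_ (sym (ℤ.*-identityʳ (+ m))) (sym (ℤ.*-identityʳ (+ n))) (ℤ.+≤+ m≤n))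

InA-downward-closed : ∀ {n k} (V : Fin k → Vec ℕ n) → AntiBlocking V → ∀ a x →
  InA V a → (∀ i → lookup x i ℕ.≤ lookup a i) → InA V x
InA-downward-closed V antiBlocking a x a∈A x≤a =
  antiBlocking _ _ a∈A (λ i → ℕtoℚ-mono-≤ {0} {lookup x i} z≤n , ℕtoℚ-mono-≤ (x≤a i))

count-∷-≡ : ∀ j xs → countℕ j (j ∷ xs) ≡ suc (countℕ j xs)
count-∷-≡ j xs with j ℕ.≟ j
... | yes _   = refl
... | no j≢j = contradiction refl j≢j

count-∷-≢ : ∀ {j x} xs → j ≢ x → countℕ j (x ∷ xs) ≡ countℕ j xs
count-∷-≢ {j} {x} xs j≢x with j ℕ.≟ x
... | yes j≡x = contradiction j≡x j≢x
... | no _    = refl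

count-++ : ∀ j xs ys → countℕ j (xs ++ ys) ≡ countℕ j xs + countℕ j ys
count-++ j []       ys = refl
count-++ j (x ∷ xs) ys with j ℕ.≟ x
... | yes _ = cong suc (count-++ j xs ys)
... | no _  = count-++ j xs ys

count-take-≤ : ∀ j m xs → countℕ j (take m xs) ℕ.≤ countℕ j xs
count-take-≤ j zero    xs       = z≤n
count-take-≤ j (suc m) []       = z≤n
count-take-≤ j (suc m) (x ∷ xs) with j ℕ.≟ x
... | yes _ = ℕ.s≤s (count-take-≤ j m xs)
... | no _  = count-take-≤ j m xs

count-replicate : ∀ m j → countℕ j (replicate m j) ≡ m
count-replicate zero    j = refl
count-replicate (suc m) j = trans (count-∷-≡ j _) (cong suc (count-replicate m j))

count-absent : ∀ {j xs} → All (j ≢_) xs → countℕ j xs ≡ 0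
count-absent []                      = refl
count-absent {xs = _ ∷ xs} (j≢x ∷ ps) = trans (count-∷-≢ xs j≢x) (count-absent ps)

count-two : ∀ {i j xs} → i ≢ j → All (λ x → x ≡ i ⊎ x ≡ j) xs →
  countℕ i xs + countℕ j xs ≡ length xs
count-two i≢j [] = refl
count-two {i} {j} {_ ∷ xs} i≢j (inj₁ refl ∷ ps) = begin
  countℕ i (i ∷ xs) + countℕ j (i ∷ xs) ≡⟨ cong₂ _+_ (count-∷-≡ i xs) (count-∷-≢ xs (i≢j ∘ sym)) ⟩
  suc (countℕ i xs + countℕ j xs)       ≡⟨ cong suc (count-two i≢j ps) ⟩
  suc (length xs)                       ∎
  where open ≡-Reasoning
count-two {i} {j} {_ ∷ xs} i≢j (inj₂ refl ∷ ps) = begin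
  countℕ i (j ∷ xs) + countℕ j (j ∷ xs) ≡⟨ cong₂ _+_ (count-∷-≢ xs i≢j) (count-∷-≡ j xs) ⟩
  countℕ i xs + suc (countℕ j xs)       ≡⟨ ℕ.+-suc (countℕ i xs) (countℕ j xs) ⟩
  suc (countℕ i xs + countℕ j xs)       ≡⟨ cong suc (count-two i≢j ps) ⟩
  suc (length xs)                       ∎
  where open ≡-Reasoning

take-++ : ∀ {A : Set} m (xs ys : List A) → take m (xs ++ ys) ≡ take m xs ++ take (m ∸ length xs) ys
take-++ zero    xs       ys = cong (λ t → take t ys) (sym (ℕ.0∸n≡0 (length xs)))
take-++ (suc m) []       ys = refl
take-++ (suc m) (x ∷ xs) ys = cong (x ∷_) (take-++ m xs ys)

between-m-and-2+m : ∀ {m x} → m ℕ.≤ x → x ℕ.< m + 2 → x ≡ m ⊎ x ≡ suc m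
between-m-and-2+m {m} {x} m≤x x<m+2 with ℕ.m≤n⇒m<n∨m≡n m≤x
... | inj₂ m≡x = inj₁ (sym m≡x)
... | inj₁ m<x = inj₂ (ℕ.≤-antisym (ℕ.≤-pred (subst (x ℕ.<_) (ℕ.+-comm m 2) x<m+2)) m<x)

indexFrom-++ : ∀ {A : Set} i (xs ys : List A) →
  indexFrom i (xs ++ ys) ≡ indexFrom i xs ++ indexFrom (i + length xs) ys
indexFrom-++ i []       ys = cong (λ t → indexFrom t ys) (sym (ℕ.+-identityʳ i))
indexFrom-++ i (x ∷ xs) ys = cong ((i , x) ∷_) (trans (indexFrom-++ (suc i) xs ys)
  (cong (λ t → indexFrom (suc i) xs ++ indexFrom t ys) (sym (ℕ.+-suc i (length xs)))))

indexFrom-bounds : ∀ {A : Set} i (xs : List A) →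
  All (λ e → i ℕ.≤ proj₁ e × proj₁ e ℕ.< i + length xs) (indexFrom i xs)
indexFrom-bounds i []       = []
indexFrom-bounds i (x ∷ xs) =
  (ℕ.≤-refl , ℕ.m<m+n i (ℕ.s≤s z≤n)) ∷ All.map widen (indexFrom-bounds (suc i) xs)
  where
  widen : ∀ {j} → suc i ℕ.≤ j × j ℕ.< suc i + length xs → i ℕ.≤ j × j ℕ.< i + suc (length xs)
  widen {j} (i<j , j<) = ℕ.<⇒≤ i<j , subst (j ℕ.<_) (sym (ℕ.+-suc i (length xs))) j<

indexFrom-All : ∀ {A : Set} {P : A → Set} i {xs} → All P xs → All (P ∘ proj₂) (indexFrom i xs)
indexFrom-All i []         = []
indexFrom-All i (px ∷ pxs) = px ∷ indexFrom-All (suc i) pxs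

Pk-block : ∀ {n} → Fin n → ℕ × (Vec ℕ n × Vec Sign n) → List ℕ
Pk-block k (j , p) = replicate (mult k p) j

-- Pk k Λ is Pk-from k 1 Λ definitionally.
Pk-from : ∀ {n} → Fin n → ℕ → SignedList n → List ℕ
Pk-from k i Λ = concat (map (Pk-block k) (indexFrom i Λ))

Pk-from-++ : ∀ {n} (k : Fin n) i (Λ Λ′ : SignedList n) →
  Pk-from k i (Λ ++ Λ′) ≡ Pk-from k i Λ ++ Pk-from k (i + length Λ) Λ′
Pk-from-++ k i Λ Λ′ = begin
  concat (map (Pk-block k) (indexFrom i (Λ ++ Λ′)))
    ≡⟨ cong (concat ∘ map (Pk-block k)) (indexFrom-++ i Λ Λ′) ⟩
  concat (map (Pk-block k) (indexFrom i Λ ++ indexFrom (i + length Λ) Λ′))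
    ≡⟨ cong concat (List.map-++ (Pk-block k) (indexFrom i Λ) _) ⟩
  concat (map (Pk-block k) (indexFrom i Λ) ++ map (Pk-block k) (indexFrom (i + length Λ) Λ′))
    ≡⟨ List.concat-++ (map (Pk-block k) (indexFrom i Λ)) _ ⟨
  Pk-from k i Λ ++ Pk-from k (i + length Λ) Λ′ ∎
  where open ≡-Reasoning

Pk-from-All : ∀ {n} {P : ℕ → Set} (k : Fin n) i (Λ : SignedList n) →
  All (P ∘ proj₁) (indexFrom i Λ) → All P (Pk-from k i Λ)
Pk-from-All k i []      []         = []
Pk-from-All k i (p ∷ Λ) (Pi ∷ Ps) =
  All.++⁺ (All.replicate⁺ (mult k p) Pi) (Pk-from-All k (suc i) Λ Ps)

Pk-from-bounds : ∀ {n} (k : Fin n) i (Λ : SignedList n) →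
  All (λ j → i ℕ.≤ j × j ℕ.< i + length Λ) (Pk-from k i Λ)
Pk-from-bounds k i Λ = Pk-from-All k i Λ (indexFrom-bounds i Λ)

count-Pk-from : ∀ {n} i (Λ : SignedList n) →
  All (λ e → ∀ k → countℕ (proj₁ e) (Pk-from k i Λ) ≡ mult k (proj₂ e)) (indexFrom i Λ)
count-Pk-from i []      = []
count-Pk-from i (p ∷ Λ) =
  own-block ∷ All.zipWith (λ {e} → later-block {e}) (indexFrom-bounds (suc i) Λ , count-Pk-from (suc i) Λ)
  where
  own-block : ∀ k → countℕ i (Pk-from k i (p ∷ Λ)) ≡ mult k p
  own-block k = begin
    countℕ i (replicate (mult k p) i ++ Pk-from k (suc i) Λ)
      ≡⟨ count-++ i (replicate (mult k p) i) _ ⟩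
    countℕ i (replicate (mult k p) i) + countℕ i (Pk-from k (suc i) Λ)
      ≡⟨ cong₂ _+_ (count-replicate (mult k p) i)
           (count-absent (All.map (λ bounds → ℕ.<⇒≢ (proj₁ bounds)) (Pk-from-bounds k (suc i) Λ))) ⟩
    mult k p + 0
      ≡⟨ ℕ.+-identityʳ (mult k p) ⟩
    mult k p ∎
    where open ≡-Reasoning
  later-block : ∀ {e} →
    (suc i ℕ.≤ proj₁ e × proj₁ e ℕ.< suc i + length Λ) ×
    (∀ k → countℕ (proj₁ e) (Pk-from k (suc i) Λ) ≡ mult k (proj₂ e)) →
    ∀ k → countℕ (proj₁ e) (Pk-from k i (p ∷ Λ)) ≡ mult k (proj₂ e)
  later-block {j , q} ((i<j , _) , count≡) k = begin
    countℕ j (replicate (mult k p) i ++ Pk-from k (suc i) Λ)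
      ≡⟨ count-++ j (replicate (mult k p) i) _ ⟩
    countℕ j (replicate (mult k p) i) + countℕ j (Pk-from k (suc i) Λ)
      ≡⟨ cong (_+ _) (count-absent (All.replicate⁺ (mult k p) (ℕ.>⇒≢ i<j))) ⟩
    countℕ j (Pk-from k (suc i) Λ)
      ≡⟨ count≡ k ⟩
    mult k q ∎
    where open ≡-Reasoning

mult-≤ : ∀ {n} (k : Fin n) a ε → mult k (a , ε) ℕ.≤ lookup a k
mult-≤ k a ε with lookup ε k
... | Sign.+ = ℕ.≤-refl
... | Sign.- = z≤n

◃-≤-mult : ∀ {n} (k : Fin n) a ε → lookup ε k ◃ lookup a k ≤ + mult k (a , ε)
◃-≤-mult k a ε with lookup ε k
... | Sign.+ = ℤ.≤-reflexive (ℤ.+◃n≡+n (lookup a k))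
... | Sign.- = subst (_≤ + 0) (sym (ℤ.-◃n≡-n (lookup a k))) ℤ.neg-≤-pos

lookup-ω-∷ : ∀ {n} a ε (Λ : SignedList n) k →
  lookup (ω ((a , ε) ∷ Λ)) k ≡ (lookup ε k ◃ lookup a k) ℤ.+ lookup (ω Λ) k
lookup-ω-∷ a ε Λ k = trans (Vec.lookup-zipWith ℤ._+_ k (signed ε a) (ω Λ))
  (cong (ℤ._+ lookup (ω Λ) k) (Vec.lookup-zipWith _◃_ k ε a))

ω-≤-length-Pk-from : ∀ {n} (k : Fin n) i (Λ : SignedList n) → lookup (ω Λ) k ≤ + length (Pk-from k i Λ)
ω-≤-length-Pk-from k i []            = ℤ.≤-reflexive (Vec.lookup-replicate k (+ 0))
ω-≤-length-Pk-from k i ((a , ε) ∷ Λ) = begin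
  lookup (ω ((a , ε) ∷ Λ)) k
    ≡⟨ lookup-ω-∷ a ε Λ k ⟩
  (lookup ε k ◃ lookup a k) ℤ.+ lookup (ω Λ) k
    ≤⟨ ℤ.+-mono-≤ (◃-≤-mult k a ε) (ω-≤-length-Pk-from k (suc i) Λ) ⟩
  + (mult k (a , ε) + length (Pk-from k (suc i) Λ))
    ≡⟨ cong (λ m → + (m + _)) (List.length-replicate (mult k (a , ε))) ⟨
  + (length (replicate (mult k (a , ε)) i) + length (Pk-from k (suc i) Λ))
    ≡⟨ cong +_ (List.length-++ (replicate (mult k (a , ε)) i)) ⟨
  + length (Pk-from k i ((a , ε) ∷ Λ)) ∎
  where open ℤ.≤-Reasoning

c-vec : ∀ {n} → SignedList n → ℕ → Vec ℕ n
c-vec Λ j = tabulate (c Λ j)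

ν-++ : ∀ {n} (L X : SignedList n) → ν (L ++ X) ≡
  map (c-vec (L ++ X) ∘ proj₁) (indexFrom 1 L) ++ map (c-vec (L ++ X) ∘ proj₁) (indexFrom (suc (length L)) X)
ν-++ L X = trans (cong (map (c-vec (L ++ X) ∘ proj₁)) (indexFrom-++ 1 L X)) (List.map-++ _ (indexFrom 1 L) _)

ν-⊆-A : ∀ {n k} (V : Fin k → Vec ℕ n) → AntiBlocking V →
  (Λ : SignedList n) → All (InA V ∘ proj₁) Λ → All (InA V) (ν Λ)
ν-⊆-A V antiBlocking Λ Λ⊆A =
  All.map⁺ (All.zipWith (λ {e} → c-vec-∈-A {e}) (indexFrom-All 1 Λ⊆A , count-Pk-from 1 Λ))
  where
  c-vec-∈-A : ∀ {e} →
    InA V (proj₁ (proj₂ e)) × (∀ k → countℕ (proj₁ e) (Pk k Λ) ≡ mult k (proj₂ e)) → InA V (c-vec Λ (proj₁ e))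
  c-vec-∈-A {j , (a , ε)} (a∈A , count≡) = InA-downward-closed V antiBlocking a (c-vec Λ j) a∈A λ k → begin
    lookup (c-vec Λ j) k                            ≡⟨ Vec.lookup∘tabulate (c Λ j) k ⟩
    countℕ j (take ∣ lookup (ω Λ) k ∣ (Pk k Λ))    ≤⟨ count-take-≤ j ∣ lookup (ω Λ) k ∣ (Pk k Λ) ⟩
    countℕ j (Pk k Λ)                               ≡⟨ count≡ k ⟩
    mult k (a , ε)                                  ≤⟨ mult-≤ k a ε ⟩
    lookup a k                                      ∎
    where open ℕ.≤-Reasoning

module _ {n} (L X : SignedList n) (k : Fin n) where
  private
    w : ℕ
    w = ∣ lookup (ω (L ++ X)) k ∣
    P Q : List ℕ
    P = Pk-from k 1 L
    Q = Pk-from k (suc (length L)) X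

  c-++ : ∀ j → c (L ++ X) j k ≡ countℕ j (take w P) + countℕ j (take (w ∸ length P) Q)
  c-++ j = begin
    countℕ j (take w (Pk-from k 1 (L ++ X)))        ≡⟨ cong (countℕ j ∘ take w) (Pk-from-++ k 1 L X) ⟩
    countℕ j (take w (P ++ Q))                      ≡⟨ cong (countℕ j) (take-++ w P Q) ⟩
    countℕ j (take w P ++ take (w ∸ length P) Q)    ≡⟨ count-++ j (take w P) _ ⟩
    countℕ j (take w P) + countℕ j (take (w ∸ length P) Q) ∎
    where open ≡-Reasoning

  c-prefix : ∀ {j} → j ℕ.< suc (length L) → c (L ++ X) j k ≡ countℕ j (take w P)
  c-prefix {j} j<m = begin
    c (L ++ X) j k
      ≡⟨ c-++ j ⟩
    countℕ j (take w P) + countℕ j (take (w ∸ length P) Q)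
      ≡⟨ cong (λ t → countℕ j (take w P) + t) (count-absent j∉Q) ⟩
    countℕ j (take w P) + 0
      ≡⟨ ℕ.+-identityʳ _ ⟩
    countℕ j (take w P) ∎
    where
    open ≡-Reasoning
    j∉Q : All (j ≢_) (take (w ∸ length P) Q)
    j∉Q = All.take⁺ (w ∸ length P)
      (All.map (λ bounds → ℕ.<⇒≢ (ℕ.<-≤-trans j<m (proj₁ bounds))) (Pk-from-bounds k (suc (length L)) X))

  c-suffix : ∀ {j} → length L ℕ.< j → c (L ++ X) j k ≡ countℕ j (take (w ∸ length P) Q)
  c-suffix {j} m≤j = trans (c-++ j) (cong (_+ countℕ j (take (w ∸ length P) Q)) (count-absent j∉P))
    where
    j∉P : All (j ≢_) (take w P)
    j∉P = All.take⁺ w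
      (All.map (λ bounds → ℕ.>⇒≢ (ℕ.<-≤-trans (proj₂ bounds) m≤j)) (Pk-from-bounds k 1 L))

  -- This is where 0 ≤ ω_k(Λ) is needed: together with ω_k(Λ) ≤ |P_k(Λ)| it makes the truncation by take exact.
  length-taken-from-suffix : + 0 ≤ lookup (ω (L ++ X)) k → length (take (w ∸ length P) Q) ≡ w ∸ length P
  length-taken-from-suffix ω≥0 =
    trans (List.length-take _ Q) (ℕ.m≤n⇒m⊓n≡m (ℕ.m≤n+o⇒m∸n≤o w (length P) (ℤ.drop‿+≤+ +w≤|P|+|Q|)))
    where
    open ℤ.≤-Reasoning
    +w≤|P|+|Q| : + w ≤ + (length P + length Q)
    +w≤|P|+|Q| = begin
      + w                                      ≡⟨ ℤ.0≤i⇒+∣i∣≡i ω≥0 ⟩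
      lookup (ω (L ++ X)) k                    ≤⟨ ω-≤-length-Pk-from k 1 (L ++ X) ⟩
      + length (Pk-from k 1 (L ++ X))          ≡⟨ cong (+_ ∘ length) (Pk-from-++ k 1 L X) ⟩
      + length (P ++ Q)                        ≡⟨ cong +_ (List.length-++ P) ⟩
      + (length P + length Q)                  ∎

c-prefix-cong : ∀ {n} (L X Y : SignedList n) k {j} → ω (L ++ X) ≡ ω (L ++ Y) →
  j ℕ.< suc (length L) → c (L ++ X) j k ≡ c (L ++ Y) j k
c-prefix-cong L X Y k {j} ω≡ j<m = begin
  c (L ++ X) j k
    ≡⟨ c-prefix L X k j<m ⟩
  countℕ j (take ∣ lookup (ω (L ++ X)) k ∣ (Pk-from k 1 L))
    ≡⟨ cong (λ v → countℕ j (take ∣ lookup v k ∣ (Pk-from k 1 L))) ω≡ ⟩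
  countℕ j (take ∣ lookup (ω (L ++ Y)) k ∣ (Pk-from k 1 L))
    ≡⟨ c-prefix L Y k j<m ⟨
  c (L ++ Y) j k ∎
  where open ≡-Reasoning

ν-prefix-cong : ∀ {n} (L X Y : SignedList n) → ω (L ++ X) ≡ ω (L ++ Y) →
  map (c-vec (L ++ X) ∘ proj₁) (indexFrom 1 L) ≡ map (c-vec (L ++ Y) ∘ proj₁) (indexFrom 1 L)
ν-prefix-cong L X Y ω≡ = List.map-cong-local
  (All.map (λ bounds → Vec.tabulate-cong (λ k → c-prefix-cong L X Y k ω≡ (proj₂ bounds))) (indexFrom-bounds 1 L))

c-last-two-sum : ∀ {n} (L : SignedList n) p q k → + 0 ≤ lookup (ω (L ++ p ∷ q ∷ [])) k →
  c (L ++ p ∷ q ∷ []) (1 + length L) k + c (L ++ p ∷ q ∷ []) (2 + length L) k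
    ≡ ∣ lookup (ω (L ++ p ∷ q ∷ [])) k ∣ ∸ length (Pk-from k 1 L)
c-last-two-sum L p q k ω≥0 = begin
  c (L ++ X) m k + c (L ++ X) (suc m) k
    ≡⟨ cong₂ _+_ (c-suffix L X k ℕ.≤-refl) (c-suffix L X k (ℕ.n≤1+n m)) ⟩
  countℕ m T + countℕ (suc m) T
    ≡⟨ count-two (ℕ.<⇒≢ (ℕ.n<1+n m)) (All.take⁺ u (All.map (λ (m≤x , x<) → between-m-and-2+m m≤x x<)
                                                          (Pk-from-bounds k m X))) ⟩
  length T
    ≡⟨ length-taken-from-suffix L X k ω≥0 ⟩
  u ∎
  where
  open ≡-Reasoning
  X : SignedList _
  X = p ∷ q ∷ []
  m u : ℕ
  m = suc (length L)
  u = ∣ lookup (ω (L ++ X)) k ∣ ∸ length (Pk-from k 1 L)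
  T : List ℕ
  T = take u (Pk-from k m X)

last-two-sums-cong : ∀ {n} (L : SignedList n) p q p′ q′ →
  ω (L ++ p ∷ q ∷ []) ≡ ω (L ++ p′ ∷ q′ ∷ []) → (∀ k → + 0 ≤ lookup (ω (L ++ p ∷ q ∷ [])) k) → ∀ k →
  lookup (c-vec (L ++ p ∷ q ∷ []) (1 + length L)) k + lookup (c-vec (L ++ p ∷ q ∷ []) (2 + length L)) k
    ≡ lookup (c-vec (L ++ p′ ∷ q′ ∷ []) (1 + length L)) k
      + lookup (c-vec (L ++ p′ ∷ q′ ∷ []) (2 + length L)) k
last-two-sums-cong L p q p′ q′ ω≡ ω≥0 k = begin
  lookup (c-vec Λ m) k + lookup (c-vec Λ (suc m)) k
    ≡⟨ lookup-c-vec-sum Λ ⟩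
  c Λ m k + c Λ (suc m) k
    ≡⟨ c-last-two-sum L p q k (ω≥0 k) ⟩
  ∣ lookup (ω Λ) k ∣ ∸ length (Pk-from k 1 L)
    ≡⟨ cong (λ v → ∣ lookup v k ∣ ∸ length (Pk-from k 1 L)) ω≡ ⟩
  ∣ lookup (ω Λ′) k ∣ ∸ length (Pk-from k 1 L)
    ≡⟨ c-last-two-sum L p′ q′ k (subst (λ v → + 0 ≤ lookup v k) ω≡ (ω≥0 k)) ⟨
  c Λ′ m k + c Λ′ (suc m) k
    ≡⟨ lookup-c-vec-sum Λ′ ⟨
  lookup (c-vec Λ′ m) k + lookup (c-vec Λ′ (suc m)) k ∎
  where
  open ≡-Reasoning
  Λ Λ′ : SignedList _
  Λ = L ++ p ∷ q ∷ []
  Λ′ = L ++ p′ ∷ q′ ∷ []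
  m : ℕ
  m = suc (length L)
  lookup-c-vec-sum : ∀ Γ → lookup (c-vec Γ m) k + lookup (c-vec Γ (suc m)) k ≡ c Γ m k + c Γ (suc m) k
  lookup-c-vec-sum Γ = cong₂ _+_ (Vec.lookup∘tabulate (c Γ m) k) (Vec.lookup∘tabulate (c Γ (suc m)) k)

All-++-pair⁻ : ∀ {A : Set} {P : A → Set} xs {y z} → All P (xs ++ y ∷ z ∷ []) → All P xs × P y × P z
All-++-pair⁻ xs all with All.++⁻ xs all
... | all-xs , Py ∷ Pz ∷ [] = all-xs , Py , Pz

toricImage-lookup : ∀ {n} (u : Monomial n) i → lookup (proj₁ (toricImage u)) i ≡ + sum (map (λ a → lookup a i) u)
toricImage-lookup []      i = Vec.lookup-replicate i (+ 0)
toricImage-lookup (a ∷ u) i = begin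
  lookup (Vec.zipWith ℤ._+_ (Vec.map +_ a) (proj₁ (toricImage u))) i
    ≡⟨ Vec.lookup-zipWith ℤ._+_ i (Vec.map +_ a) _ ⟩
  lookup (Vec.map +_ a) i ℤ.+ lookup (proj₁ (toricImage u)) i
    ≡⟨ cong₂ ℤ._+_ (Vec.lookup-map i +_ a) (toricImage-lookup u i) ⟩
  + (lookup a i + sum (map (λ a → lookup a i) u)) ∎
  where open ≡-Reasoning

quadratic-binomial-in-toric-ideal : ∀ {n} (c₁ d₁ c₂ d₂ : Vec ℕ n) →
  (∀ i → lookup c₁ i + lookup d₁ i ≡ lookup c₂ i + lookup d₂ i) →
  BinomialInToricIdeal (c₁ ∷ d₁ ∷ []) (c₂ ∷ d₂ ∷ [])
quadratic-binomial-in-toric-ideal c₁ d₁ c₂ d₂ sums≡ = cong (_, 2) (Pointwise-≡⇒≡ (ext λ i → begin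
  lookup (proj₁ (toricImage (c₁ ∷ d₁ ∷ []))) i  ≡⟨ toricImage-lookup (c₁ ∷ d₁ ∷ []) i ⟩
  + (lookup c₁ i + (lookup d₁ i + 0))           ≡⟨ cong (λ t → + (lookup c₁ i + t)) (ℕ.+-identityʳ _) ⟩
  + (lookup c₁ i + lookup d₁ i)                 ≡⟨ cong +_ (sums≡ i) ⟩
  + (lookup c₂ i + lookup d₂ i)                 ≡⟨ cong (λ t → + (lookup c₂ i + t)) (ℕ.+-identityʳ _) ⟨
  + (lookup c₂ i + (lookup d₂ i + 0))           ≡⟨ toricImage-lookup (c₂ ∷ d₂ ∷ []) i ⟨
  lookup (proj₁ (toricImage (c₂ ∷ d₂ ∷ []))) i  ∎))
  where open ≡-Reasoning

lemma3p7 : ∀ (n k : ℕ) (V : Fin k → Vec ℕ n) →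
  AntiBlocking V → FullDimensional V →
  ∀ (L : SignedList n) (a b a′ b′ : Vec ℕ n) (ε δ ε′ δ′ : Vec Sign n) →
  All (λ p → InA V (proj₁ p)) L →
  InA V a → InA V b → InA V a′ → InA V b′ →
  ω (L ++ (a , ε) ∷ (b , δ) ∷ []) ≡ ω (L ++ (a′ , ε′) ∷ (b′ , δ′) ∷ []) →
  (∀ i → + 0 ≤ lookup (ω (L ++ (a , ε) ∷ (b , δ) ∷ [])) i) →
  Σ (Monomial n) λ M → Σ (Vec ℕ n) λ c₁ → Σ (Vec ℕ n) λ d₁ →
    Σ (Vec ℕ n) λ c₂ → Σ (Vec ℕ n) λ d₂ →
      All (InA V) M × InA V c₁ × InA V d₁ × InA V c₂ × InA V d₂ ×
      BinomialInToricIdeal (c₁ ∷ d₁ ∷ []) (c₂ ∷ d₂ ∷ []) ×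
      (mν (L ++ (a , ε) ∷ (b , δ) ∷ []) ↭ M ++ c₁ ∷ d₁ ∷ []) ×
      (mν (L ++ (a′ , ε′) ∷ (b′ , δ′) ∷ []) ↭ M ++ c₂ ∷ d₂ ∷ [])
lemma3p7 n k V antiBlocking _ L a b a′ b′ ε δ ε′ δ′ L⊆A a∈A b∈A a′∈A b′∈A ω≡ω′ ω≥0 =
  let M⊆A , c₁∈A , d₁∈A = All-++-pair⁻ M (subst (All (InA V)) νΛ≡ νΛ⊆A)
      _   , c₂∈A , d₂∈A = All-++-pair⁻ M (subst (All (InA V)) νΛ′≡ νΛ′⊆A)
  in M , c₁ , d₁ , c₂ , d₂ , M⊆A , c₁∈A , d₁∈A , c₂∈A , d₂∈A ,
     quadratic-binomial-in-toric-ideal c₁ d₁ c₂ d₂ (last-two-sums-cong L _ _ _ _ ω≡ω′ ω≥0) ,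
     ↭-reflexive νΛ≡ , ↭-reflexive νΛ′≡
  where
  Λ Λ′ : SignedList n
  Λ = L ++ (a , ε) ∷ (b , δ) ∷ []
  Λ′ = L ++ (a′ , ε′) ∷ (b′ , δ′) ∷ []
  M : Monomial n
  M = map (c-vec Λ ∘ proj₁) (indexFrom 1 L)
  c₁ d₁ c₂ d₂ : Vec ℕ n
  c₁ = c-vec Λ (1 + length L)
  d₁ = c-vec Λ (2 + length L)
  c₂ = c-vec Λ′ (1 + length L)
  d₂ = c-vec Λ′ (2 + length L)
  νΛ≡ : ν Λ ≡ M ++ c₁ ∷ d₁ ∷ []
  νΛ≡ = ν-++ L _
  νΛ′≡ : ν Λ′ ≡ M ++ c₂ ∷ d₂ ∷ []
  νΛ′≡ = trans (ν-++ L _) (cong (_++ c₂ ∷ d₂ ∷ []) (ν-prefix-cong L _ _ (sym ω≡ω′)))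
  νΛ⊆A : All (InA V) (ν Λ)
  νΛ⊆A = ν-⊆-A V antiBlocking Λ (All.++⁺ L⊆A (a∈A ∷ b∈A ∷ []))
  νΛ′⊆A : All (InA V) (ν Λ′)
  νΛ′⊆A = ν-⊆-A V antiBlocking Λ′ (All.++⁺ L⊆A (a′∈A ∷ b′∈A ∷ []))
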